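{- Let $n,k,d$ be positive integers and suppose there is a binary LCD $[n,k,d]$ code $C$. If $d(n-1,k) \le d-1$, then $d(C^\perp) \ge 2$.
   Context: All codes are binary linear codes; an $[n,k,d]$ code is a $k$-dimensional subspace of $\mathbb{F}_2^n$ with minimum nonzero Hamming weight $d$; $d(D)$ denotes the minimum nonzero weight of a code $D$. A code $C$ is LCD if $C \cap C^\perp = \{\mathbf{0}_n\}$, where $C^\perp$ is the dual with respect to the standard inner product. $d(n,k)$ denotes the largest minimum weight among all binary LCD $[n,k]$ codes. -}

module Defs where

open import Data.Bool using (Bool; true; false; _xor_; _∧_)
open import Data.Nat using (ℕ; zero; suc; _+_)
open import Data.Vec using (Vec; []; _∷_; zipWith; replicate; foldr)
open import Data.Product using (∃; _×_)
open import Relation.Binary.PropositionalEquality using (_≡_)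
open import Relation.Nullary using (¬_)
open import Data.Nat using (_≤_)

-- Vectors of F₂ⁿ (false = 0, true = 1)
Word : ℕ → Set
Word n = Vec Bool n

zeroW : ∀ {n} → Word n
zeroW = replicate _ false

_⊕_ : ∀ {n} → Word n → Word n → Word n
_⊕_ = zipWith _xor_

wt : ∀ {n} → Word n → ℕ
wt [] = 0
wt (true ∷ xs) = suc (wt xs)
wt (false ∷ xs) = wt xs

dot : ∀ {n} → Word n → Word n → Bool
dot x y = foldr _ _xor_ false (zipWith _∧_ x y)

combine : ∀ {n k} → Vec Bool k → Vec (Word n) k → Word n
combine [] [] = zeroW
combine (true ∷ ms) (g ∷ gs) = g ⊕ combine ms gs
combine (false ∷ ms) (g ∷ gs) = combine ms gs

-- A binary linear [n,k] code: a k-dimensional subspace of F₂ⁿ, given as the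
-- span of k linearly independent vectors (a basis / generator matrix).
record Code (n k : ℕ) : Set where
  field
    gen   : Vec (Word n) k
    indep : ∀ (m : Vec Bool k) → combine m gen ≡ zeroW → m ≡ replicate k false

open Code public

_∈C_ : ∀ {n k} → Word n → Code n k → Set
x ∈C C = ∃ λ (m : Vec Bool _) → combine m (gen C) ≡ x

_∈⊥_ : ∀ {n k} → Word n → Code n k → Set
y ∈⊥ C = ∀ x → x ∈C C → dot x y ≡ false

IsLCD : ∀ {n k} → Code n k → Set
IsLCD C = ∀ x → x ∈C C → x ∈⊥ C → x ≡ zeroW

MinWeight : ∀ {n} → (Word n → Set) → ℕ → Set
MinWeight P w =
  (∃ λ x → P x × ¬ (x ≡ zeroW) × wt x ≡ w) ×
  (∀ x → P x → ¬ (x ≡ zeroW) → w ≤ wt x)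

-- Only 0 has weight 0, so it suffices to rule out a weight-one word eᵢ in C⊥.
-- Such a word forces every codeword of C to vanish at coordinate i. Deleting
-- that coordinate is then injective and weight-preserving on C and preserves
-- inner products, so it yields an LCD [n-1,k,d] code, contradicting
-- d(n-1,k) ≤ d-1.
module Submission where

open import Defs
open import Data.Bool using (Bool; true; false; _xor_; _∧_)
open import Data.Empty using (⊥-elim)
open import Data.Fin using (Fin; zero; suc)
open import Data.Nat using (ℕ; zero; suc; pred; _≤_; _∸_; NonZero; s≤s; z≤n; z<s)
open import Data.Nat.Properties using (≤∧≢⇒<; <⇒≱; ∸-monoʳ-<)
open import Data.Product using (Σ; _,_; proj₁)
open import Data.Vec using (Vec; []; _∷_; head; tail; lookup; map; removeAt)
open import Relation.Binary.PropositionalEquality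

private
  variable
    m k : ℕ

wt≡0⇒zeroW : (x : Word m) → wt x ≡ 0 → x ≡ zeroW
wt≡0⇒zeroW []          _  = refl
wt≡0⇒zeroW (false ∷ x) eq = cong (false ∷_) (wt≡0⇒zeroW x eq)

minWeight-positive : {P : Word m → Set} {w : ℕ} → MinWeight P w → 1 ≤ w
minWeight-positive {w = zero}  ((x , _ , x≢0 , wtx≡0) , _) = ⊥-elim (x≢0 (wt≡0⇒zeroW x wtx≡0))
minWeight-positive {w = suc w} _                            = s≤s z≤n

dot-zeroʳ : (x : Word m) → dot x zeroW ≡ false
dot-zeroʳ []          = refl
dot-zeroʳ (false ∷ x) = dot-zeroʳ x
dot-zeroʳ (true ∷ x)  = dot-zeroʳ x

wt≡1⇒dot≡lookup : (y : Word (suc m)) → wt y ≡ 1 →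
  Σ (Fin (suc m)) λ i → ∀ x → dot x y ≡ lookup x i
wt≡1⇒dot≡lookup (true ∷ y) eq rewrite wt≡0⇒zeroW y (cong pred eq) =
  zero , λ { (false ∷ x) → dot-zeroʳ x ; (true ∷ x) → cong (true xor_) (dot-zeroʳ x) }
wt≡1⇒dot≡lookup {zero} (false ∷ []) ()
wt≡1⇒dot≡lookup {suc m} (false ∷ y) eq with wt≡1⇒dot≡lookup y eq
... | i , dot≡lookup = suc i , λ { (false ∷ x) → dot≡lookup x ; (true ∷ x) → dot≡lookup x }

removeAt-⊕ : (x y : Word (suc m)) (i : Fin (suc m)) →
  removeAt (x ⊕ y) i ≡ removeAt x i ⊕ removeAt y i
removeAt-⊕ (_ ∷ _) (_ ∷ _) zero = refl
removeAt-⊕ (_ ∷ x@(_ ∷ _)) (_ ∷ y@(_ ∷ _)) (suc i) = cong (_ ∷_) (removeAt-⊕ x y i)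

removeAt-zeroW : (i : Fin (suc m)) → removeAt zeroW i ≡ zeroW
removeAt-zeroW zero = refl
removeAt-zeroW {suc m} (suc i) = cong (false ∷_) (removeAt-zeroW i)

removeAt-combine : (ms : Vec Bool k) (gs : Vec (Word (suc m)) k) (i : Fin (suc m)) →
  removeAt (combine ms gs) i ≡ combine ms (map (λ g → removeAt g i) gs)
removeAt-combine []          []       i = removeAt-zeroW i
removeAt-combine (false ∷ ms) (g ∷ gs) i = removeAt-combine ms gs i
removeAt-combine (true ∷ ms)  (g ∷ gs) i = begin
  removeAt (g ⊕ combine ms gs) i            ≡⟨ removeAt-⊕ g (combine ms gs) i ⟩
  removeAt g i ⊕ removeAt (combine ms gs) i ≡⟨ cong (removeAt g i ⊕_) (removeAt-combine ms gs i) ⟩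
  removeAt g i ⊕ combine ms (map (λ g → removeAt g i) gs) ∎
  where open ≡-Reasoning

wt-removeAt : (x : Word (suc m)) (i : Fin (suc m)) → lookup x i ≡ false →
  wt (removeAt x i) ≡ wt x
wt-removeAt (false ∷ x) zero    _ = refl
wt-removeAt (false ∷ x@(_ ∷ _)) (suc i) xᵢ≡0 = wt-removeAt x i xᵢ≡0
wt-removeAt (true ∷ x@(_ ∷ _))  (suc i) xᵢ≡0 = cong suc (wt-removeAt x i xᵢ≡0)

dot-removeAt : (x y : Word (suc m)) (i : Fin (suc m)) → lookup x i ≡ false →
  dot (removeAt x i) (removeAt y i) ≡ dot x y
dot-removeAt (false ∷ x) (b ∷ y) zero    _ = refl
dot-removeAt (a ∷ x@(_ ∷ _)) (b ∷ y@(_ ∷ _)) (suc i) xᵢ≡0 =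
  cong ((a ∧ b) xor_) (dot-removeAt x y i xᵢ≡0)

removeAt≡zeroW⇒≡zeroW : (x : Word (suc m)) (i : Fin (suc m)) → lookup x i ≡ false →
  removeAt x i ≡ zeroW → x ≡ zeroW
removeAt≡zeroW⇒≡zeroW (false ∷ x) zero    _ x′≡0 = cong (false ∷_) x′≡0
removeAt≡zeroW⇒≡zeroW (a ∷ x@(_ ∷ _)) (suc i) xᵢ≡0 x′≡0 =
  cong₂ _∷_ (cong head x′≡0) (removeAt≡zeroW⇒≡zeroW x i xᵢ≡0 (cong tail x′≡0))

module _ (C : Code (suc m) k) (i : Fin (suc m))
         (vanishes : ∀ x → x ∈C C → lookup x i ≡ false) where

  private
    gen′ : Vec (Word m) k
    gen′ = map (λ g → removeAt g i) (gen C)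

    combine-gen′ : ∀ ms → combine ms gen′ ≡ removeAt (combine ms (gen C)) i
    combine-gen′ ms = sym (removeAt-combine ms (gen C) i)

    vanishesAt : ∀ ms → lookup (combine ms (gen C)) i ≡ false
    vanishesAt ms = vanishes _ (ms , refl)

    reflects-zeroW : ∀ ms → combine ms gen′ ≡ zeroW → combine ms (gen C) ≡ zeroW
    reflects-zeroW ms eq =
      removeAt≡zeroW⇒≡zeroW (combine ms (gen C)) i (vanishesAt ms) (trans (sym (combine-gen′ ms)) eq)

    preserves-zeroW : ∀ ms → combine ms (gen C) ≡ zeroW → combine ms gen′ ≡ zeroW
    preserves-zeroW ms eq =
      trans (combine-gen′ ms) (trans (cong (λ c → removeAt c i) eq) (removeAt-zeroW i))

    preserves-wt : ∀ ms → wt (combine ms gen′) ≡ wt (combine ms (gen C))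
    preserves-wt ms =
      trans (cong wt (combine-gen′ ms)) (wt-removeAt (combine ms (gen C)) i (vanishesAt ms))

  puncture : Code m k
  puncture = record { gen = gen′ ; indep = λ ms eq → indep C ms (reflects-zeroW ms eq) }

  puncture-LCD : IsLCD C → IsLCD puncture
  puncture-LCD lcd _ (ms , refl) c′⊥ = preserves-zeroW ms (lcd _ (ms , refl) c⊥)
    where
    c⊥ : combine ms (gen C) ∈⊥ C
    c⊥ _ (ms′ , refl) = begin
      dot (combine ms′ (gen C)) (combine ms (gen C))
        ≡⟨ sym (dot-removeAt (combine ms′ (gen C)) (combine ms (gen C)) i (vanishesAt ms′)) ⟩
      dot (removeAt (combine ms′ (gen C)) i) (removeAt (combine ms (gen C)) i)
        ≡⟨ sym (cong₂ dot (combine-gen′ ms′) (combine-gen′ ms)) ⟩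
      dot (combine ms′ gen′) (combine ms gen′)
        ≡⟨ c′⊥ _ (ms′ , refl) ⟩
      false ∎
      where open ≡-Reasoning

  puncture-MinWeight : ∀ {d} → MinWeight (_∈C C) d → MinWeight (_∈C puncture) d
  puncture-MinWeight {d} ((_ , (ms , refl) , c≢0 , wt≡d) , minimal) =
    ( combine ms gen′ , (ms , refl)
    , (λ eq → c≢0 (reflects-zeroW ms eq)) , trans (preserves-wt ms) wt≡d ) ,
    λ { _ (ms′ , refl) c′≢0 →
          subst (d ≤_) (sym (preserves-wt ms′))
                (minimal _ (ms′ , refl) (λ eq → c′≢0 (preserves-zeroW ms′ eq))) }

lemma2p2 : (n k d : ℕ) → .{{NonZero n}} → .{{NonZero k}} → .{{NonZero d}} →
    (C : Code n k) → IsLCD C → MinWeight (λ x → x ∈C C) d →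
    (∀ (D : Code (n ∸ 1) k) → IsLCD D → ∀ w → MinWeight (λ x → x ∈C D) w → w ≤ d ∸ 1) →
    ∀ w → MinWeight (λ y → y ∈⊥ C) w → 2 ≤ w
lemma2p2 (suc m) k d C lcd minC bound w min⊥ = ≤∧≢⇒< (minWeight-positive min⊥) w≢1
  where
  w≢1 : 1 ≢ w
  w≢1 refl with proj₁ min⊥
  ... | y , y⊥C , _ , wty≡1 with wt≡1⇒dot≡lookup y wty≡1
  ... | i , dot≡lookup = <⇒≱ (∸-monoʳ-< z<s (minWeight-positive minC)) d≤d∸1
    where
    vanishes : ∀ x → x ∈C C → lookup x i ≡ false
    vanishes x x∈C = trans (sym (dot≡lookup x)) (y⊥C x x∈C)

    d≤d∸1 : d ≤ d ∸ 1
    d≤d∸1 = bound (puncture C i vanishes) (puncture-LCD C i vanishes lcd) d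
                  (puncture-MinWeight C i vanishes minC)
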